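{- Let $D$ be a digraph on $\{1,\dots,n\}$. There exist $q\ge2$, a complete schedule $\sigma$ and $f\in F[D,q]$ such that $f^\sigma$ is a permutation of $[q]^n$ if and only if every vertex of $D$ belongs to a cycle.
   Context: A digraph $D=(V,E)$ has $V=\{1,\dots,n\}$, $E\subseteq V^2$ (loops allowed; a loop is a cycle). With $[q]=\{0,\dots,q-1\}$, for $f:[q]^n\to[q]^n$, $\mathrm{IG}(f)$ is the digraph on $V$ with $(u,v)$ an arc iff $f_v$ depends essentially on $x_u$; $F[D,q]=\{f:\mathrm{IG}(f)=D\}$. A schedule is a sequence $\sigma=(\sigma_1,\dots,\sigma_t)$ of subsets of $V$; for $S\subseteq V$, $f^{(S)}_v(x)=f_v(x)$ if $v\in S$ and $x_v$ otherwise; $f^\sigma=f^{(\sigma_t)}\circ\dots\circ f^{(\sigma_1)}$. $\sigma$ is complete if $\bigcup_i\sigma_i=V$. -}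

module Defs where

open import Data.Nat using (ℕ)
open import Data.Bool using (Bool; true; false; if_then_else_)
open import Data.Fin using (Fin)
open import Data.Vec using (Vec; lookup; tabulate; _[_]≔_)
open import Data.List using (List; foldl)
open import Data.List.Membership.Propositional using (_∈_)
open import Data.Product using (Σ; ∃; _×_)
open import Relation.Binary.PropositionalEquality using (_≡_; _≢_)
open import Relation.Binary.Construct.Closure.Transitive using (TransClosure)
open import Function.Definitions using (Bijective)
open import Function.Bundles using (_⇔_)

-- A digraph on the vertex set Fin n (= {1,…,n}); the arc set E ⊆ V² is
-- given by its characteristic function; loops are allowed.
Digraph : ℕ → Set
Digraph n = Fin n → Fin n → Bool

Arc : ∀ {n} → Digraph n → Fin n → Fin n → Set
Arc D u v = D u v ≡ true

-- v belongs to a cycle: there is a closed walk of length ≥ 1 from v to v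
-- (a loop is a cycle of length 1).
OnCycle : ∀ {n} → Digraph n → Fin n → Set
OnCycle D v = TransClosure (Arc D) v v

Config : ℕ → ℕ → Set
Config q n = Vec (Fin q) n

Network : ℕ → ℕ → Set
Network q n = Config q n → Config q n

DependsOn : ∀ {q n} → Network q n → Fin n → Fin n → Set
DependsOn {q} {n} f u v =
  Σ (Config q n) λ x → Σ (Fin q) λ a → lookup (f x) v ≢ lookup (f (x [ u ]≔ a)) v

HasIG : ∀ {q n} → Network q n → Digraph n → Set
HasIG f D = ∀ u v → Arc D u v ⇔ DependsOn f u v

VSubset : ℕ → Set
VSubset n = Fin n → Bool

Schedule : ℕ → Set
Schedule n = List (VSubset n)

Complete : ∀ {n} → Schedule n → Set
Complete {n} σ = ∀ (v : Fin n) → Σ (VSubset n) λ S → S ∈ σ × S v ≡ true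

update : ∀ {q n} → Network q n → VSubset n → Network q n
update f S x = tabulate λ v → if S v then lookup (f x) v else lookup x v

run : ∀ {q n} → Network q n → Schedule n → Network q n
run f σ x = foldl (λ y S → update f S y) x σ

IsPermutation : ∀ {q n} → Network q n → Set
IsPermutation g = Bijective _≡_ _≡_ g

-- If v lies on no cycle, let G be the set of vertices that are neither v nor
-- reachable from v.  G is closed under taking in-neighbours and contains every
-- in-neighbour of v, so two configurations agreeing on G still agree on G after
-- any update, and also agree at v once v has been updated.  An injective f^σ
-- is a permutation of the finite set [q]^n, so some power (f^σ)^m fixes both
-- x and x with its v-th entry changed; but these differ at v while their images
-- agree there.
--
-- Conversely, take q = 2, let f_w be the xor of the in-neighbours of w, and for
-- each vertex v update in one step all vertices c₀ = v, c₁, …, c_K = v of a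
-- shortest cycle through v.  Minimality forbids chords cᵢ → c_{j+1} with i < j,
-- so the new value at c_{j+1} together with the already recovered old values at
-- c_{j+1}, …, c_{K-1} determines the old value at c_j: each block update is
-- injective, hence so is f^σ, and an injective self-map of [2]^n is a bijection.

module Submission where

open import Defs
open import Algebra.Bundles using (CommutativeRing)
open import Data.Bool using (Bool; true; false; _∧_; _xor_; if_then_else_)
open import Data.Bool.Properties renaming (_≟_ to _≟ᵇ_) using (xor-∧-commutativeRing; xor-same; xor-identityʳ)
open import Algebra.Properties.CommutativeMonoid.Sum (CommutativeRing.+-commutativeMonoid xor-∧-commutativeRing)
  using (∑-distrib-+; sum-remove; sum-cong-≋; sum-replicate-zero) renaming (sum to ⨁)
open import Data.Empty using (⊥-elim)
open import Data.Fin using (Fin; zero; suc; toℕ; combine; punchIn; _≟_)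
open import Data.Fin.Properties using (combine-injective; pigeonhole; punchInᵢ≢i; toℕ≤pred[n]; any?; 2↔Bool)
open import Data.List using ([]; _∷_; map; allFin)
open import Data.List.Membership.Propositional using (_∈_; _∉_)
open import Data.List.Membership.Propositional.Properties using (∈-allFin; ∈-map⁺; ∈-map⁻)
open import Data.List.Relation.Unary.Any using (here; there)
open import Data.Nat using (ℕ; zero; suc; _+_; _*_; _∸_; _^_; _≤_; _<_; z≤n; s≤s; s≤s⁻¹; s<s⁻¹; _<?_)
open import Data.Nat.GeneralisedArithmetic using (fold; fold-+)
open import Data.Nat.Induction using (<-rec)
open import Data.Nat.Properties
  using (n<1+n; +-suc; +-assoc; +-identityʳ; *-comm; m≤n⇒∃[o]m+o≡n; m+[n∸m]≡n; +-monoˡ-<;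
         <⇒≤; <⇒≱; n≤1+n; +-comm; ≮⇒≥; ≤-trans; m≤n⇒m<n∨m≡n; <-cmp; anyUpTo?; module ≤-Reasoning)
open import Data.Product using (Σ; ∃; _×_; _,_)
open import Data.Sum using (_⊎_; inj₁; inj₂; map₁)
open import Data.Vec using (Vec; []; _∷_; lookup; tabulate; replicate; _[_]≔_)
open import Data.Vec.Properties
  using (lookup∘tabulate; tabulate∘lookup; tabulate-cong; lookup∘update; lookup∘update′; []≔-lookup; lookup-replicate)
open import Function using (_∘_)
open import Function.Bundles using (_⇔_; mk⇔; Equivalence; Inverse; Injection)
open import Function.Construct.Composition using (_⇔-∘_)
open import Function.Construct.Symmetry using (↔-sym; ⇔-sym)
open import Function.Properties.Inverse using (↔⇒↣)
open import Function.Definitions using (Injective; Surjective)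
open import Relation.Binary using (tri<; tri≈; tri>)
open import Relation.Binary.Construct.Closure.Transitive using (TransClosure; [_]; _∷_; _∷ʳ_)
open import Relation.Binary.PropositionalEquality
open import Relation.Nullary using (Dec; yes; no; ¬_; does; contradiction)
open import Relation.Nullary.Decidable using (_×-dec_; map′; dec-true; dec-false; decidable-stable)

lookup-extensional : ∀ {a} {A : Set a} {n} (x y : Vec A n) → (∀ i → lookup x i ≡ lookup y i) → x ≡ y
lookup-extensional x y same = begin
  x                     ≡⟨ tabulate∘lookup x ⟨
  tabulate (lookup x)   ≡⟨ tabulate-cong same ⟩
  tabulate (lookup y)   ≡⟨ tabulate∘lookup y ⟩
  y                     ∎
  where open ≡-Reasoning

module _ {p} {P : ℕ → Set p} where

  LeastWitness : Set p
  LeastWitness = ∃ λ k → P k × (∀ {ℓ} → ℓ < k → ¬ P ℓ)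

  leastWitness : (∀ m → Dec (P m)) → ∀ {m} → P m → LeastWitness
  leastWitness P? {m} = <-rec (λ m → P m → LeastWitness) search m
    where
    search : ∀ m → (∀ {ℓ} → ℓ < m → P ℓ → LeastWitness) → P m → LeastWitness
    search m smaller Pm with anyUpTo? P? m
    ... | yes (ℓ , ℓ<m , Pℓ) = smaller ℓ<m Pℓ
    ... | no none            = m , Pm , λ ℓ<m Pℓ → none (_ , ℓ<m , Pℓ)

  descendingInduction : ∀ K → (∀ {j} → j < K → (∀ {i} → j < i → i < K → P i) → P j) →
                        ∀ {j} → j < K → P j
  descendingInduction K step = downFrom K (+-identityʳ K) z≤n
    where
    downFrom : ∀ r {j} → r + j ≡ K → ∀ {i} → j ≤ i → i < K → P i
    downFrom zero refl j≤i i<K = ⊥-elim (<⇒≱ i<K j≤i)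
    downFrom (suc r) {j} r+j≡K {i} j≤i i<K with m≤n⇒m<n∨m≡n j≤i
    ... | inj₁ j<i = downFrom r (trans (+-suc r j) r+j≡K) j<i i<K
    ... | inj₂ refl = step i<K (downFrom r (trans (+-suc r j) r+j≡K))

module _ {a} {A : Set a} (F : A → A) where

  fold-injective : Injective _≡_ _≡_ F → ∀ k {x y} → fold x F k ≡ fold y F k → x ≡ y
  fold-injective F-inj zero    same = same
  fold-injective F-inj (suc k) same = fold-injective F-inj k (F-inj same)

  fold-period-* : ∀ {x} p → fold x F p ≡ x → ∀ k → fold x F (k * p) ≡ x
  fold-period-* p Fᵖx≡x zero = refl
  fold-period-* {x} p Fᵖx≡x (suc k) = begin
    fold x F (p + k * p)           ≡⟨ fold-+ x F p ⟩
    fold (fold x F (k * p)) F p    ≡⟨ cong (λ z → fold z F p) (fold-period-* p Fᵖx≡x k) ⟩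
    fold x F p                     ≡⟨ Fᵖx≡x ⟩
    x                              ∎
    where open ≡-Reasoning

  fold-preserves : ∀ {r} (R : A → A → Set r) → (∀ {x y} → R x y → R (F x) (F y)) →
                   ∀ k {x y} → R x y → R (fold x F k) (fold y F k)
  fold-preserves R F-pres zero    Rxy = Rxy
  fold-preserves R F-pres (suc k) Rxy = F-pres (fold-preserves R F-pres k Rxy)

  module _ {N} {encode : A → Fin N} (encode-inj : Injective _≡_ _≡_ encode)
           (F-inj : Injective _≡_ _≡_ F) where

    periodic : ∀ x → ∃ λ p → fold x F (suc p) ≡ x
    periodic x with pigeonhole (n<1+n N) (λ i → encode (fold x F (toℕ i)))
    ... | i , j , i<j , same with m≤n⇒∃[o]m+o≡n i<j
    ... | o , i+1+o≡j = o , sym (fold-injective F-inj (toℕ i) (begin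
      fold x F (toℕ i)                  ≡⟨ encode-inj same ⟩
      fold x F (toℕ j)                  ≡⟨ cong (fold x F) (trans (sym i+1+o≡j) (sym (+-suc (toℕ i) o))) ⟩
      fold x F (toℕ i + suc o)          ≡⟨ fold-+ x F (toℕ i) ⟩
      fold (fold x F (suc o)) F (toℕ i) ∎))
      where open ≡-Reasoning

    commonPeriod : ∀ x y → ∃ λ m → fold x F (suc m) ≡ x × fold y F (suc m) ≡ y
    commonPeriod x y with periodic x | periodic y
    ... | p , Fx | p′ , Fy =
      p + p′ * suc p , fold-period-* (suc p) Fx (suc p′)
        , subst (λ m → fold y F m ≡ y) (*-comm (suc p) (suc p′)) (fold-period-* (suc p′) Fy (suc p))

    injective⇒surjective : Surjective _≡_ _≡_ F
    injective⇒surjective y = let p , Fy = periodic y in fold y F p , λ { refl → Fy }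

encode : ∀ {q n} → Config q n → Fin (q ^ n)
encode []      = zero
encode (a ∷ x) = combine a (encode x)

encode-injective : ∀ {q n} → Injective _≡_ _≡_ (encode {q} {n})
encode-injective {x = []}    {[]}    _    = refl
encode-injective {x = a ∷ x} {b ∷ y} same with combine-injective a (encode x) b (encode y) same
... | refl , same′ = cong (a ∷_) (encode-injective same′)

module _ {q n} (f : Network q n) (S : VSubset n) where

  lookup-update-selected : ∀ {u} x → S u ≡ true → lookup (update f S x) u ≡ lookup (f x) u
  lookup-update-selected {u} x Su = trans (lookup∘tabulate _ u) (cong (λ b → if b then _ else _) Su)

  lookup-update-unselected : ∀ {u} x → S u ≡ false → lookup (update f S x) u ≡ lookup x u
  lookup-update-unselected {u} x Su = trans (lookup∘tabulate _ u) (cong (λ b → if b then _ else _) Su)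

  update-agreeAt : ∀ {u x y} → (S u ≡ true → lookup (f x) u ≡ lookup (f y) u) →
                   (S u ≡ false → lookup x u ≡ lookup y u) →
                   lookup (update f S x) u ≡ lookup (update f S y) u
  update-agreeAt {u} {x} {y} selected unselected with S u in Su
  ... | true  = trans (lookup-update-selected x Su) (trans (selected refl) (sym (lookup-update-selected y Su)))
  ... | false = trans (lookup-update-unselected x Su) (trans (unselected refl) (sym (lookup-update-unselected y Su)))

  module _ {x y} (same : update f S x ≡ update f S y) where

    update-≡⇒selected : ∀ {u} → S u ≡ true → lookup (f x) u ≡ lookup (f y) u
    update-≡⇒selected {u} Su = begin
      lookup (f x) u             ≡⟨ lookup-update-selected x Su ⟨
      lookup (update f S x) u    ≡⟨ cong (λ z → lookup z u) same ⟩
      lookup (update f S y) u    ≡⟨ lookup-update-selected y Su ⟩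
      lookup (f y) u             ∎
      where open ≡-Reasoning

    update-≡⇒unselected : ∀ {u} → S u ≡ false → lookup x u ≡ lookup y u
    update-≡⇒unselected {u} Su = begin
      lookup x u                 ≡⟨ lookup-update-unselected x Su ⟨
      lookup (update f S x) u    ≡⟨ cong (λ z → lookup z u) same ⟩
      lookup (update f S y) u    ≡⟨ lookup-update-unselected y Su ⟩
      lookup y u                 ∎
      where open ≡-Reasoning

run-injective : ∀ {q n} (f : Network q n) (σ : Schedule n) →
                (∀ {S} → S ∈ σ → Injective _≡_ _≡_ (update f S)) → Injective _≡_ _≡_ (run f σ)
run-injective f []      inj same = same
run-injective f (S ∷ σ) inj same = inj (here refl) (run-injective f σ (inj ∘ there) same)

Scheduled : ∀ {n} → Schedule n → Fin n → Set
Scheduled {n} σ v = Σ (VSubset n) λ S → S ∈ σ × S v ≡ true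

module Walks {n} (D : Digraph n) where

  private
    variable
      a b c v : Fin n
      ℓ m i j : ℕ

  Walk : ℕ → Fin n → Fin n → Set
  Walk zero    a b = a ≡ b
  Walk (suc ℓ) a b = Σ (Fin n) λ c → Arc D a c × Walk ℓ c b

  walk? : ∀ ℓ a b → Dec (Walk ℓ a b)
  walk? zero    a b = a ≟ b
  walk? (suc ℓ) a b = any? (λ c → (D a c ≟ᵇ true) ×-dec walk? ℓ c b)

  ⁺⇒walk : TransClosure (Arc D) a b → ∃ λ ℓ → Walk (suc ℓ) a b
  ⁺⇒walk {b = b} [ arc ] = 0 , b , arc , refl
  ⁺⇒walk (arc ∷ path) = let ℓ , w = ⁺⇒walk path in suc ℓ , _ , arc , w

  walk⇒⁺ : Walk (suc ℓ) a b → TransClosure (Arc D) a b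
  walk⇒⁺ {zero}  (c , arc , refl) = [ arc ]
  walk⇒⁺ {suc ℓ} (c , arc , w)    = arc ∷ walk⇒⁺ w

  node : Walk ℓ a b → ℕ → Fin n
  node {zero}  {a} _           _       = a
  node {suc ℓ} {a} _           zero    = a
  node {suc ℓ}     (_ , _ , w) (suc i) = node w i

  node-last : (w : Walk ℓ a b) → node w ℓ ≡ b
  node-last {zero}  w           = w
  node-last {suc ℓ} (_ , _ , w) = node-last w

  node-arc : (w : Walk ℓ a b) → i < ℓ → Arc D (node w i) (node w (suc i))
  node-arc {suc zero}    {i = zero}  (_ , arc , refl) _ = arc
  node-arc {suc (suc ℓ)} {i = zero}  (_ , arc , _)    _ = arc
  node-arc {suc ℓ}       {i = suc i} (_ , _ , w)   i<ℓ  = node-arc w (s<s⁻¹ i<ℓ)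

  prefix : (w : Walk ℓ a b) → i ≤ ℓ → Walk i a (node w i)
  prefix {zero}  {i = zero}  _             _   = refl
  prefix {suc ℓ} {i = zero}  _             _   = refl
  prefix {suc ℓ} {i = suc i} (c , arc , w) i≤ℓ = c , arc , prefix w (s≤s⁻¹ i≤ℓ)

  suffix : (w : Walk ℓ a b) → i ≤ ℓ → Walk (ℓ ∸ i) (node w i) b
  suffix {zero}  {i = zero}  w           _   = w
  suffix {suc ℓ} {i = zero}  w           _   = w
  suffix {suc ℓ} {i = suc i} (_ , _ , w) i≤ℓ = suffix w (s≤s⁻¹ i≤ℓ)

  _++_ : Walk ℓ a b → Walk m b c → Walk (ℓ + m) a c
  _++_ {zero}  refl          w′ = w′
  _++_ {suc ℓ} (c , arc , w) w′ = c , arc , w ++ w′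

  bypass : (w : Walk ℓ a b) → i ≤ j → j ≤ ℓ → Walk m (node w i) (node w j) →
           Walk (i + (m + (ℓ ∸ j))) a b
  bypass w i≤j j≤ℓ bridge = prefix w (≤-trans i≤j j≤ℓ) ++ (bridge ++ suffix w j≤ℓ)

  bypass-shorter : i + m < j → j ≤ ℓ → i + (m + (ℓ ∸ j)) < ℓ
  bypass-shorter {i} {m} {j} {ℓ} i+m<j j≤ℓ = begin-strict
    i + (m + (ℓ ∸ j))   ≡⟨ +-assoc i m (ℓ ∸ j) ⟨
    i + m + (ℓ ∸ j)     <⟨ +-monoˡ-< (ℓ ∸ j) i+m<j ⟩
    j + (ℓ ∸ j)         ≡⟨ m+[n∸m]≡n j≤ℓ ⟩
    ℓ                   ∎
    where open ≤-Reasoning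

  ShortWalk : Fin n → Fin n → Set
  ShortWalk a b = ∃ λ ℓ → ℓ < n × Walk ℓ a b

  shorten : Walk ℓ a b → ShortWalk a b
  shorten {ℓ} = <-rec (λ ℓ → ∀ {a b} → Walk ℓ a b → ShortWalk a b) go ℓ
    where
    go : ∀ ℓ → (∀ {ℓ′} → ℓ′ < ℓ → ∀ {a b} → Walk ℓ′ a b → ShortWalk a b) →
         ∀ {a b} → Walk ℓ a b → ShortWalk a b
    go ℓ shorter w with ℓ <? n
    ... | yes ℓ<n = ℓ , ℓ<n , w
    ... | no ℓ≮n with pigeonhole (n<1+n n) (λ i → node w (toℕ i))
    ... | i , j , i<j , repeated =
      shorter (bypass-shorter {toℕ i} {0} i+0<j j≤ℓ) (bypass w (<⇒≤ i<j) j≤ℓ repeated)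
      where
      i+0<j : toℕ i + 0 < toℕ j
      i+0<j = subst (_< toℕ j) (sym (+-identityʳ (toℕ i))) i<j
      j≤ℓ : toℕ j ≤ ℓ
      j≤ℓ = ≤-trans (toℕ≤pred[n] j) (≮⇒≥ ℓ≮n)

  onCycle? : ∀ v → Dec (OnCycle D v)
  onCycle? v = map′ (λ (_ , _ , w) → walk⇒⁺ w) short (anyUpTo? (λ ℓ → walk? (suc ℓ) v v) n)
    where
    short : OnCycle D v → ∃ λ ℓ → ℓ < n × Walk (suc ℓ) v v
    short cycle with ⁺⇒walk cycle
    ... | _ , c , arc , w = let ℓ , ℓ<n , w′ = shorten w in ℓ , ℓ<n , c , arc , w′

  record ShortestCycle (v : Fin n) : Set where
    field
      k        : ℕ
      cycle    : Walk (suc k) v v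
      shortest : ∀ {ℓ} → ℓ < k → ¬ Walk (suc ℓ) v v

  shortestCycle : OnCycle D v → ShortestCycle v
  shortestCycle {v} onCycle =
    let _ , w = ⁺⇒walk onCycle
        k , cycle , shortest = leastWitness (λ ℓ → walk? (suc ℓ) v v) w
    in record { k = k ; cycle = cycle ; shortest = shortest }

AgreeOn : ∀ {q n} → (Fin n → Set) → Config q n → Config q n → Set
AgreeOn G x y = ∀ {u} → G u → lookup x u ≡ lookup y u

InClosed : ∀ {n} → Digraph n → (Fin n → Set) → Set
InClosed D G = ∀ {u w} → Arc D u w → G w → G u

module _ {q n} {D : Digraph n} (f : Network q n) (hasIG : HasIG f D) where

  update-invisible : ∀ {u w} x a → (Arc D u w → lookup x u ≡ a) →
                     lookup (f x) w ≡ lookup (f (x [ u ]≔ a)) w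
  update-invisible {u} {w} x a unchanged with D u w in arc
  ... | true  = cong (λ z → lookup (f z) w) (sym x[u]≔a≡x)
    where
    x[u]≔a≡x : x [ u ]≔ a ≡ x
    x[u]≔a≡x = trans (cong (x [ u ]≔_) (sym (unchanged refl))) ([]≔-lookup x u)
  ... | false = decidable-stable (_ ≟ _) λ differ →
                  contradiction (trans (sym arc) (Equivalence.from (hasIG u w) (x , a , differ))) λ ()

  inNeighbours-determine : ∀ w {x y} → AgreeOn (λ u → Arc D u w) x y → lookup (f x) w ≡ lookup (f y) w
  inNeighbours-determine w {x} {y} agree =
    replaceAll (allFin n) x λ { (inj₁ u∉) → ⊥-elim (u∉ (∈-allFin _)) ; (inj₂ arc) → agree arc }
    where
    replaceAll : ∀ L x → AgreeOn (λ u → u ∉ L ⊎ Arc D u w) x y → lookup (f x) w ≡ lookup (f y) w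
    replaceAll []      x agree′ =
      cong (λ z → lookup (f z) w) (lookup-extensional x y λ u → agree′ (inj₁ λ ()))
    replaceAll (u ∷ L) x agree′ =
      trans (update-invisible x (lookup y u) (agree′ ∘ inj₂)) (replaceAll L (x [ u ]≔ lookup y u) agree″)
      where
      agree″ : AgreeOn (λ u′ → u′ ∉ L ⊎ Arc D u′ w) (x [ u ]≔ lookup y u) y
      agree″ {u′} h with u ≟ u′
      ... | yes refl = lookup∘update u x _
      ... | no u≢u′  = trans (lookup∘update′ (u≢u′ ∘ sym) x _) (agree′ (map₁ u′∉L⇒u′∉u∷L h))
        where
        u′∉L⇒u′∉u∷L : u′ ∉ L → u′ ∉ u ∷ L
        u′∉L⇒u′∉u∷L u′∉L (here refl)   = u≢u′ refl
        u′∉L⇒u′∉u∷L u′∉L (there u′∈L) = u′∉L u′∈L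

  module _ {G : Fin n → Set} (closed : InClosed D G) where

    update-preserves : ∀ S {x y} → AgreeOn G x y → AgreeOn G (update f S x) (update f S y)
    update-preserves S agree {u} Gu =
      update-agreeAt f S (λ _ → inNeighbours-determine u (λ arc → agree (closed arc Gu))) (λ _ → agree Gu)

    run-preserves : ∀ σ {x y} → AgreeOn G x y → AgreeOn G (run f σ x) (run f σ y)
    run-preserves []      agree = agree
    run-preserves (S ∷ σ) agree = run-preserves σ (update-preserves S agree)

  module _ {G : Fin n → Set} (closed : InClosed D G) {v} (feeds : ∀ {u} → Arc D u v → G u) where

    G⁺ : Fin n → Set
    G⁺ u = G u ⊎ u ≡ v

    closed⁺ : InClosed D G⁺
    closed⁺ arc (inj₁ Gw)   = inj₁ (closed arc Gw)
    closed⁺ arc (inj₂ refl) = inj₁ (feeds arc)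

    run-extends : ∀ σ → Scheduled σ v → ∀ {x y} → AgreeOn G x y → AgreeOn G⁺ (run f σ x) (run f σ y)
    run-extends (S ∷ σ) (_ , here refl , Sv) {x} {y} agree = run-preserves closed⁺ σ agree⁺
      where
      agree⁺ : AgreeOn G⁺ (update f S x) (update f S y)
      agree⁺ (inj₁ Gu)   = update-preserves closed S agree Gu
      agree⁺ (inj₂ refl) = begin
        lookup (update f S x) v   ≡⟨ lookup-update-selected f S x Sv ⟩
        lookup (f x) v            ≡⟨ inNeighbours-determine v (agree ∘ feeds) ⟩
        lookup (f y) v            ≡⟨ lookup-update-selected f S y Sv ⟨
        lookup (update f S y) v   ∎
        where open ≡-Reasoning
    run-extends (S ∷ σ) (T , there T∈σ , Tv) agree =
      run-extends σ (T , T∈σ , Tv) (update-preserves closed S agree)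

    notInjective : ∀ σ → Scheduled σ v → ∀ {x y} → AgreeOn G x y → lookup x v ≢ lookup y v →
                   ¬ Injective _≡_ _≡_ (run f σ)
    notInjective σ scheduled {x} {y} agree differ inj with commonPeriod (run f σ) encode-injective inj x y
    ... | m , Fx , Fy = differ (begin
      lookup x v                ≡⟨ cong (λ z → lookup z v) Fx ⟨
      lookup (F (fold x F m)) v ≡⟨ run-extends σ scheduled agreeᵐ (inj₂ refl) ⟩
      lookup (F (fold y F m)) v ≡⟨ cong (λ z → lookup z v) Fy ⟩
      lookup y v                ∎)
      where
      open ≡-Reasoning
      F : Network q n
      F = run f σ
      agreeᵐ : AgreeOn G (fold x F m) (fold y F m)
      agreeᵐ = fold-preserves F (AgreeOn G) (run-preserves closed σ) m agree

module _ {n} (D : Digraph n) (v : Fin n) where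

  Unreached : Fin n → Set
  Unreached u = ¬ TransClosure (Arc D) v u × u ≢ v

  unreached-inClosed : InClosed D Unreached
  unreached-inClosed arc (unreached , _) =
    (λ path → unreached (path ∷ʳ arc)) , λ { refl → unreached [ arc ] }

  unreached-feeds : ¬ OnCycle D v → ∀ {u} → Arc D u v → Unreached u
  unreached-feeds acyclic arc = (λ path → acyclic (path ∷ʳ arc)) , λ { refl → acyclic [ arc ] }

offCycle⇒notInjective : ∀ {q n} {D : Digraph n} (f : Network (suc (suc q)) n) → HasIG f D →
                        ∀ {v σ} → ¬ OnCycle D v → Scheduled σ v → ¬ Injective _≡_ _≡_ (run f σ)
offCycle⇒notInjective {n = n} {D} f hasIG {v} {σ} acyclic scheduled =
  notInjective f hasIG (unreached-inClosed D v) (unreached-feeds D v acyclic) σ scheduled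
    {x = x₀} {y = x₀ [ v ]≔ suc zero}
    (λ (_ , u≢v) → sym (lookup∘update′ u≢v x₀ _))
    (λ same → contradiction (trans (sym (lookup-replicate v zero)) (trans same (lookup∘update v x₀ _))) λ ())
  where
  x₀ = replicate n zero

injective⇒allOnCycle : ∀ {q n} {D : Digraph n} (f : Network (suc (suc q)) n) → HasIG f D →
                       ∀ {σ} → Complete σ → Injective _≡_ _≡_ (run f σ) → ∀ v → OnCycle D v
injective⇒allOnCycle {D = D} f hasIG complete injective v with Walks.onCycle? D v
... | yes onCycle = onCycle
... | no acyclic  = ⊥-elim (offCycle⇒notInjective f hasIG acyclic (complete v) injective)

xor≡false⇔≡ : ∀ a b → (a xor b ≡ false) ⇔ (a ≡ b)
xor≡false⇔≡ a b = mk⇔ to λ { refl → xor-same a }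
  where
  to : ∀ {a b} → a xor b ≡ false → a ≡ b
  to {false} {false} _ = refl
  to {true}  {true}  _ = refl

⨁-single : ∀ {m} (t : Fin m → Bool) u₀ → (∀ {u} → u ≢ u₀ → t u ≡ false) → ⨁ t ≡ t u₀
⨁-single {suc m} t u₀ vanish = begin
  ⨁ t                               ≡⟨ sum-remove t ⟩
  t u₀ xor ⨁ (t ∘ punchIn u₀)        ≡⟨ cong (t u₀ xor_) (sum-cong-≋ (vanish ∘ punchInᵢ≢i u₀)) ⟩
  t u₀ xor ⨁ {m} (λ _ → false)       ≡⟨ cong (t u₀ xor_) (sum-replicate-zero m) ⟩
  t u₀ xor false                    ≡⟨ xor-identityʳ (t u₀) ⟩
  t u₀                              ∎
  where open ≡-Reasoning

⨁-differ-at : ∀ {m} (g h : Fin m → Bool) u₀ → (∀ {u} → u ≢ u₀ → g u ≡ h u) →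
              ⨁ g xor ⨁ h ≡ g u₀ xor h u₀
⨁-differ-at g h u₀ same = begin
  ⨁ g xor ⨁ h                  ≡⟨ ∑-distrib-+ g h ⟨
  ⨁ (λ u → g u xor h u)        ≡⟨ ⨁-single _ u₀ cancels ⟩
  g u₀ xor h u₀                ∎
  where
  open ≡-Reasoning
  cancels : ∀ {u} → u ≢ u₀ → g u xor h u ≡ false
  cancels {u} u≢u₀ = trans (cong (_xor h u) (same u≢u₀)) (xor-same (h u))

⨁-≡⇔ : ∀ {m} (g h : Fin m → Bool) u₀ → (∀ {u} → u ≢ u₀ → g u ≡ h u) →
       (⨁ g ≡ ⨁ h) ⇔ (g u₀ ≡ h u₀)
⨁-≡⇔ g h u₀ same = xor≡false⇔≡ (g u₀) (h u₀) ⇔-∘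
  subst (λ b → (⨁ g ≡ ⨁ h) ⇔ (b ≡ false)) (⨁-differ-at g h u₀ same) (⇔-sym (xor≡false⇔≡ (⨁ g) (⨁ h)))

bit : Fin 2 → Bool
bit = Inverse.to 2↔Bool

bit-injective : Injective _≡_ _≡_ bit
bit-injective = Injection.injective (↔⇒↣ 2↔Bool)

module Parity {n} (D : Digraph n) where

  parityTerm : Fin n → Config 2 n → Fin n → Bool
  parityTerm w x u = D u w ∧ bit (lookup x u)

  parity : Fin n → Config 2 n → Bool
  parity w x = ⨁ (parityTerm w x)

  parityNetwork : Network 2 n
  parityNetwork x = tabulate λ w → Inverse.from 2↔Bool (parity w x)

  parityNetwork-≡⇔ : ∀ w x y → (lookup (parityNetwork x) w ≡ lookup (parityNetwork y) w) ⇔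
                               (parity w x ≡ parity w y)
  parityNetwork-≡⇔ w x y = mk⇔
    (λ same → Injection.injective (↔⇒↣ (↔-sym 2↔Bool))
                (trans (sym (lookup∘tabulate _ w)) (trans same (lookup∘tabulate _ w))))
    (λ same → trans (lookup∘tabulate _ w)
                (trans (cong (Inverse.from 2↔Bool) same) (sym (lookup∘tabulate _ w))))

  parity-update-≡⇔ : ∀ w x u a → (parity w x ≡ parity w (x [ u ]≔ a)) ⇔
                     (D u w ∧ bit (lookup x u) ≡ D u w ∧ bit (lookup (x [ u ]≔ a) u))
  parity-update-≡⇔ w x u a =
    ⨁-≡⇔ (parityTerm w x) (parityTerm w (x [ u ]≔ a)) u λ {u′} u′≢u →
      cong (λ b → D u′ w ∧ bit b) (sym (lookup∘update′ u′≢u x a))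

  parityNetwork-hasIG : HasIG parityNetwork D
  parityNetwork-hasIG u w = mk⇔ arc⇒depends depends⇒arc
    where
    arc⇒depends : Arc D u w → DependsOn parityNetwork u w
    arc⇒depends arc = x₀ , suc zero , λ same →
      termsDiffer (Equivalence.to (parity-update-≡⇔ w x₀ u (suc zero))
                    (Equivalence.to (parityNetwork-≡⇔ w x₀ (x₀ [ u ]≔ suc zero)) same))
      where
      x₀ = replicate n zero
      termsDiffer : D u w ∧ bit (lookup x₀ u) ≢ D u w ∧ bit (lookup (x₀ [ u ]≔ suc zero) u)
      termsDiffer same = contradiction (begin
        false                       ≡⟨ cong bit (lookup-replicate u zero) ⟨
        bit (lookup x₀ u)           ≡⟨ cong (_∧ bit (lookup x₀ u)) arc ⟨
        D u w ∧ bit (lookup x₀ u)   ≡⟨ same ⟩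
        D u w ∧ bit (lookup x₁ u)   ≡⟨ cong (_∧ bit (lookup x₁ u)) arc ⟩
        bit (lookup x₁ u)           ≡⟨ cong bit (lookup∘update u x₀ (suc zero)) ⟩
        true                        ∎) λ ()
        where
        open ≡-Reasoning
        x₁ = x₀ [ u ]≔ suc zero

    depends⇒arc : DependsOn parityNetwork u w → Arc D u w
    depends⇒arc (x , a , differ) with D u w in arc
    ... | true  = refl
    ... | false = ⊥-elim (differ (Equivalence.from (parityNetwork-≡⇔ w x (x [ u ]≔ a))
                                   (Equivalence.from (parity-update-≡⇔ w x u a) termsVanish)))
      where
      termsVanish : D u w ∧ bit (lookup x u) ≡ D u w ∧ bit (lookup (x [ u ]≔ a) u)
      termsVanish = trans (cong (_∧ _) arc) (sym (cong (_∧ _) arc))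

module CycleBlock {n} {D : Digraph n} {v : Fin n} (sc : Walks.ShortestCycle D v) where

  open Walks D
  open ShortestCycle sc
  open Parity D

  K : ℕ
  K = suc k

  c : ℕ → Fin n
  c = node cycle

  Visited : Fin n → Set
  Visited u = ∃ λ i → i < K × c i ≡ u

  visited? : ∀ u → Dec (Visited u)
  visited? u = anyUpTo? (λ i → c i ≟ u) K

  block : VSubset n
  block u = does (visited? u)

  block-start : block v ≡ true
  block-start = dec-true (visited? v) (0 , s≤s z≤n , refl)

  visited-next : ∀ {j} → j < K → Visited (c (suc j))
  visited-next {j} j<K with m≤n⇒m<n∨m≡n j<K
  ... | inj₁ j+1<K = suc j , j+1<K , refl
  ... | inj₂ refl  = 0 , s≤s z≤n , sym (node-last cycle)

  no-chord : ∀ {i j} → i < j → j < K → ¬ Arc D (c i) (c (suc j))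
  no-chord {i} {j} i<j j<K arc = shortest (s<s⁻¹ (subst (_< K) (+-suc i (K ∸ suc j)) shorter))
                                          (subst (λ ℓ → Walk ℓ v v) (+-suc i (K ∸ suc j)) closed)
    where
    closed : Walk (i + (1 + (K ∸ suc j))) v v
    closed = bypass cycle (≤-trans (<⇒≤ i<j) (n≤1+n j)) j<K (c (suc j) , arc , refl)
    shorter : i + (1 + (K ∸ suc j)) < K
    shorter = bypass-shorter {i} {1} (subst (_< suc j) (+-comm 1 i) (s≤s i<j)) j<K

  block-injective : Injective _≡_ _≡_ (update parityNetwork block)
  block-injective {x} {y} same = lookup-extensional x y agree
    where
    unvisited-agree : ∀ {u} → ¬ Visited u → lookup x u ≡ lookup y u
    unvisited-agree {u} unvisited =
      update-≡⇒unselected parityNetwork block {x} {y} same (dec-false (visited? u) unvisited)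

    visited-parity : ∀ {u} → Visited u → parity u x ≡ parity u y
    visited-parity {u} visited = Equivalence.to (parityNetwork-≡⇔ u x y)
      (update-≡⇒selected parityNetwork block {x} {y} same (dec-true (visited? u) visited))

    step : ∀ {j} → j < K → (∀ {i} → j < i → i < K → lookup x (c i) ≡ lookup y (c i)) →
           lookup x (c j) ≡ lookup y (c j)
    step {j} j<K above = bit-injective (begin
      bit (lookup x (c j))             ≡⟨ cong (_∧ bit (lookup x (c j))) (node-arc cycle j<K) ⟨
      parityTerm (c (suc j)) x (c j)   ≡⟨ Equivalence.to (⨁-≡⇔ _ _ (c j) termsAgree) parityNext ⟩
      parityTerm (c (suc j)) y (c j)   ≡⟨ cong (_∧ bit (lookup y (c j))) (node-arc cycle j<K) ⟩
      bit (lookup y (c j))             ∎)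
      where
      open ≡-Reasoning
      parityNext : parity (c (suc j)) x ≡ parity (c (suc j)) y
      parityNext = visited-parity (visited-next j<K)
      termsAgree : ∀ {u} → u ≢ c j → parityTerm (c (suc j)) x u ≡ parityTerm (c (suc j)) y u
      termsAgree {u} u≢cⱼ with D u (c (suc j)) in arc | visited? u
      ... | false | _                     = refl
      ... | true  | no unvisited          = cong bit (unvisited-agree unvisited)
      ... | true  | yes (i , i<K , refl) with <-cmp i j
      ...   | tri< i<j _ _  = contradiction arc (no-chord i<j j<K)
      ...   | tri≈ _ refl _ = contradiction refl u≢cⱼ
      ...   | tri> _ _ j<i  = cong bit (above j<i i<K)

    agree : ∀ u → lookup x u ≡ lookup y u
    agree u with visited? u
    ... | yes (i , i<K , refl) = descendingInduction K step i<K
    ... | no unvisited        = unvisited-agree unvisited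

module _ {n} (D : Digraph n) (allOnCycle : ∀ v → OnCycle D v) where

  open Parity D

  cycleBlock : Fin n → VSubset n
  cycleBlock v = CycleBlock.block (Walks.shortestCycle D (allOnCycle v))

  blockSchedule : Schedule n
  blockSchedule = map cycleBlock (allFin n)

  blockSchedule-complete : Complete blockSchedule
  blockSchedule-complete v =
    cycleBlock v , ∈-map⁺ cycleBlock (∈-allFin v) ,
    CycleBlock.block-start (Walks.shortestCycle D (allOnCycle v))

  blockSchedule-permutation : IsPermutation (run parityNetwork blockSchedule)
  blockSchedule-permutation = injective , injective⇒surjective _ encode-injective injective
    where
    injective : Injective _≡_ _≡_ (run parityNetwork blockSchedule)
    injective = run-injective parityNetwork blockSchedule λ S∈σ →
      let v , _ , S≡block = ∈-map⁻ cycleBlock S∈σ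
      in subst (λ S → Injective _≡_ _≡_ (update parityNetwork S)) (sym S≡block)
           (CycleBlock.block-injective (Walks.shortestCycle D (allOnCycle v)))

corollary6 : (n : ℕ) (D : Digraph n) →
    (Σ ℕ λ q → 2 ≤ q × Σ (Schedule n) λ σ → Complete σ ×
    Σ (Network q n) λ f → HasIG f D × IsPermutation (run f σ))
    ⇔ (∀ (v : Fin n) → OnCycle D v)
corollary6 n D = mk⇔
  (λ { (_ , s≤s (s≤s z≤n) , _ , complete , f , hasIG , injective , _) →
          injective⇒allOnCycle f hasIG complete injective })
  (λ allOnCycle → 2 , s≤s (s≤s z≤n) , blockSchedule D allOnCycle , blockSchedule-complete D allOnCycle ,
                  Parity.parityNetwork D , Parity.parityNetwork-hasIG D , blockSchedule-permutation D allOnCycle)
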